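{- Let $G$ be a finite group generated by an involution $x$ and an element $y$ of order $3$, let $S=\{x,y,y^x\}$ where $y^x=x^{ -1}yx$, and let $\Gamma=\mathrm{Cay}(G,S)$. If $G$ is isomorphic to neither $\mathbb{Z}_6$ nor $\mathbb{Z}_3\wr\mathbb{Z}_2\cong\mathbb{Z}_3^2\rtimes\mathbb{Z}_2$, then $\Gamma$ has Cayley index $2$.
   Context: $\mathrm{Cay}(G,S)$ is the digraph with vertex set $G$ and arcs $(u,v)$ whenever $vu^{ -1}\in S$. $G$ acts on it by right multiplication, and the Cayley index is $|\mathrm{Aut}(\Gamma):G|$, where $\mathrm{Aut}(\Gamma)$ is the group of arc-preserving vertex permutations. -}

module Defs where

open import Data.Nat using (ℕ; suc; _*_; _%_)
import Data.Nat as ℕ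
open import Data.Nat.DivMod using (m%n<n)
open import Data.Fin using (Fin; toℕ; fromℕ<; zero; suc)
open import Data.Vec using (Vec; lookup)
open import Data.List using (List; length)
open import Data.List.Membership.Propositional using (_∈_)
open import Data.List.Relation.Unary.Unique.Propositional using (Unique)
open import Data.Product using (Σ; _×_; _,_)
open import Data.Sum using (_⊎_)
open import Relation.Binary.PropositionalEquality using (_≡_)
open import Relation.Nullary using (¬_)
open import Algebra.Structures using (IsGroup)
open import Function.Definitions using (Bijective)

-- A finite group, presented (up to isomorphism) on the carrier Fin n,
-- with propositional equality.
record FinGroup : Set where
  field
    n      : ℕ
    _∙_    : Fin n → Fin n → Fin n
    ε      : Fin n
    _⁻¹    : Fin n → Fin n
    isGroup : IsGroup _≡_ _∙_ ε _⁻¹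
  infixl 7 _∙_
  infix 8 _⁻¹

module _ (G : FinGroup) where
  open FinGroup G

  data Gen (x y : Fin n) : Fin n → Set where
    gen-x   : Gen x y x
    gen-y   : Gen x y y
    gen-ε   : Gen x y ε
    gen-∙   : ∀ {a b} → Gen x y a → Gen x y b → Gen x y (a ∙ b)
    gen-inv : ∀ {a} → Gen x y a → Gen x y (a ⁻¹)

  Generates : Fin n → Fin n → Set
  Generates x y = ∀ g → Gen x y g

  IsInvolution : Fin n → Set
  IsInvolution x = ¬ (x ≡ ε) × (x ∙ x ≡ ε)

  HasOrder3 : Fin n → Set
  HasOrder3 y = ¬ (y ≡ ε) × (y ∙ y ∙ y ≡ ε)

  CayArc : (Fin n → Set) → Fin n → Fin n → Set
  CayArc S u v = S (v ∙ u ⁻¹)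

  IsAut : (Fin n → Set) → (Fin n → Fin n) → Set
  IsAut S f = Bijective _≡_ _≡_ f
            × (∀ u v → (CayArc S u v → CayArc S (f u) (f v))
                     × (CayArc S (f u) (f v) → CayArc S u v))

HasCard : {A : Set} → (A → Set) → ℕ → Set
HasCard {A} P k =
  Σ (List A) λ L → Unique L × (∀ a → (a ∈ L → P a) × (P a → a ∈ L)) × length L ≡ k

-- Cayley index |Aut(Cay(G,S)) : G| = k, i.e. |Aut| = k * |G|
-- (G acting by right multiplication embeds as a regular subgroup of Aut).
-- Permutations are represented by their value tables (Vec (Fin n) n).
CayleyIndex : (G : FinGroup) → (Fin (FinGroup.n G) → Set) → ℕ → Set
CayleyIndex G S k =
  HasCard (λ (v : Vec (Fin (FinGroup.n G)) (FinGroup.n G)) → IsAut G S (lookup v))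
          (k * FinGroup.n G)

Isomorphic : (G : FinGroup) → (A : Set) → (A → A → A) → Set
Isomorphic G A _⋆_ = Σ (Fin n → A) λ φ →
    Bijective _≡_ _≡_ φ × (∀ a b → φ (a ∙ b) ≡ φ a ⋆ φ b)
  where open FinGroup G

addMod : ∀ {k} → Fin (suc k) → Fin (suc k) → Fin (suc k)
addMod {k} a b = fromℕ< (m%n<n (toℕ a ℕ.+ toℕ b) (suc k))

ℤ₆ : Set
ℤ₆ = Fin 6

_+₆_ : ℤ₆ → ℤ₆ → ℤ₆
a +₆ b = addMod a b

-- ℤ₃ ≀ ℤ₂ = ℤ₃² ⋊ ℤ₂, the generator of ℤ₂ swapping the two coordinates
ℤ₃≀ℤ₂ : Set
ℤ₃≀ℤ₂ = Fin 3 × Fin 3 × Fin 2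

swap₂ : Fin 2 → Fin 3 × Fin 3 → Fin 3 × Fin 3
swap₂ zero    (a , b) = a , b
swap₂ (suc _) (a , b) = b , a

_⋆≀_ : ℤ₃≀ℤ₂ → ℤ₃≀ℤ₂ → ℤ₃≀ℤ₂
(a , b , e) ⋆≀ (a' , b' , e') with swap₂ e (a' , b')
... | c , d = (addMod a c) , (addMod b d) , (addMod e e')

module Submission where

-- Colour the arc u → s ∙ u of Cay(G,S) by s ∈ {x, y, z}, where z = y^x. A y- or z-arc u → p ∙ u
-- lies on the directed triangle u → p u → p² u → u, while an x-arc lies on no directed triangle.
-- Hence an automorphism f maps x-arcs to x-arcs and, at each vertex, either keeps or swaps the
-- colours y and z. No closed walk of length three starts with a y-arc followed by a z-arc, and
-- z = x y x, so this choice propagates along x- and y-arcs; as x and y generate G it is the same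
-- at every vertex. Thus f is g ↦ g c or g ↦ g^x c, and |Aut Γ| = 2|G|. The argument needs only
-- y ≠ y^x; if y = y^x, then x y has order 6 and G ≅ ℤ₆.

open import Defs
open import Level using (0ℓ)
open import Algebra.Bundles using (Group)
open import Algebra.Structures using (IsGroup)
import Algebra.Properties.Group as GroupProperties
open import Data.Empty using (⊥-elim)
open import Data.Fin using (Fin; zero; suc; toℕ; fromℕ<; #_; _≟_)
open import Data.Fin.Properties using (all?; toℕ-fromℕ<)
open import Data.List using (List; map; _++_; allFin; length)
open import Data.List.Properties using (length-++; length-map; length-tabulate)
open import Data.List.Membership.Propositional using (_∈_)
open import Data.List.Membership.Propositional.Properties using (∈-map⁺; ∈-map⁻; ∈-++⁺ˡ; ∈-++⁺ʳ; ∈-++⁻; ∈-allFin)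
open import Data.List.Relation.Unary.Unique.Propositional using (Unique)
open import Data.List.Relation.Unary.Unique.Propositional.Properties using (++⁺; map⁺; allFin⁺)
open import Data.Nat using (ℕ; zero; suc; _+_; _*_; _∸_; _%_; _/_; NonZero)
open import Data.Nat.DivMod using (m≡m%n+[m/n]*n; m%n<n)
open import Data.Nat.Properties using (+-identityʳ)
open import Data.Product using (Σ; _×_; _,_; proj₁; proj₂)
open import Data.Sum using (_⊎_; inj₁; inj₂)
open import Data.Vec using (Vec; lookup; tabulate)
open import Data.Vec.Properties using (lookup∘tabulate; tabulate∘lookup; tabulate-cong)
open import Function.Base using (_∘_)
import Function.Construct.Composition as Composition
open import Relation.Binary.PropositionalEquality
open import Relation.Nullary using (¬_; yes; no)
open import Relation.Nullary.Decidable using (from-yes; _→-dec_)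

module FinGroupProperties (G : FinGroup) where
  open FinGroup G public
  open IsGroup isGroup public using (assoc; identityˡ; identityʳ; inverseˡ; inverseʳ)

  group : Group 0ℓ 0ℓ
  group = record { isGroup = isGroup }

  open GroupProperties group public
    using (∙-cancelˡ; ∙-cancelʳ; identityˡ-unique; inverseˡ-unique; inverseʳ-unique; ⁻¹-anti-homo-∙)

  x⁻¹∙[x∙y]≡y : ∀ a b → a ⁻¹ ∙ (a ∙ b) ≡ b
  x⁻¹∙[x∙y]≡y a b = trans (sym (assoc _ _ _)) (trans (cong (_∙ b) (inverseˡ a)) (identityˡ b))

  x∙[x⁻¹∙y]≡y : ∀ a b → a ∙ (a ⁻¹ ∙ b) ≡ b
  x∙[x⁻¹∙y]≡y a b = trans (sym (assoc _ _ _)) (trans (cong (_∙ b) (inverseʳ a)) (identityˡ b))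

  [y∙x]∙x⁻¹≡y : ∀ a b → b ∙ a ∙ a ⁻¹ ≡ b
  [y∙x]∙x⁻¹≡y a b = trans (assoc _ _ _) (trans (cong (b ∙_) (inverseʳ a)) (identityʳ b))

  [y∙x⁻¹]∙x≡y : ∀ a b → b ∙ a ⁻¹ ∙ a ≡ b
  [y∙x⁻¹]∙x≡y a b = trans (assoc _ _ _) (trans (cong (b ∙_) (inverseˡ a)) (identityʳ b))

  x∙y≡ε⇒y∙x≡ε : ∀ {a b} → a ∙ b ≡ ε → b ∙ a ≡ ε
  x∙y≡ε⇒y∙x≡ε {a} {b} e = trans (cong (_∙ a) (inverseʳ-unique a b e)) (inverseˡ a)

  x∙x≡ε⇒x⁻¹≡x : ∀ {a} → a ∙ a ≡ ε → a ⁻¹ ≡ a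
  x∙x≡ε⇒x⁻¹≡x {a} e = sym (inverseʳ-unique a a e)

  module _ {p} (p³≡ε : p ∙ p ∙ p ≡ ε) where

    [p∙p]⁻¹≡p : (p ∙ p) ⁻¹ ≡ p
    [p∙p]⁻¹≡p = sym (inverseʳ-unique (p ∙ p) p p³≡ε)

    p∙[p∙[p∙q]]≡q : ∀ q → p ∙ (p ∙ (p ∙ q)) ≡ q
    p∙[p∙[p∙q]]≡q q = begin
      p ∙ (p ∙ (p ∙ q)) ≡⟨ sym (assoc p p _) ⟩
      p ∙ p ∙ (p ∙ q)   ≡⟨ sym (assoc _ p q) ⟩
      p ∙ p ∙ p ∙ q     ≡⟨ cong (_∙ q) p³≡ε ⟩
      ε ∙ q             ≡⟨ identityˡ q ⟩
      q                 ∎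
      where open ≡-Reasoning

    p∙[p∙q]≡ε⇒q≡p : ∀ {q} → p ∙ (p ∙ q) ≡ ε → q ≡ p
    p∙[p∙q]≡ε⇒q≡p {q} e = trans (inverseʳ-unique (p ∙ p) q (trans (assoc p p q) e)) [p∙p]⁻¹≡p

    p∙[q∙p]≡ε⇒q≡p : ∀ {q} → p ∙ (q ∙ p) ≡ ε → q ≡ p
    p∙[q∙p]≡ε⇒q≡p {q} e =
      trans (inverseˡ-unique q (p ∙ p) (trans (sym (assoc q p p)) (x∙y≡ε⇒y∙x≡ε e))) [p∙p]⁻¹≡p

  x∙[y∙[z∙w]]≡w⇒x∙[y∙z]≡ε : ∀ a b c w → a ∙ (b ∙ (c ∙ w)) ≡ w → a ∙ (b ∙ c) ≡ ε
  x∙[y∙[z∙w]]≡w⇒x∙[y∙z]≡ε a b c w e =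
    identityˡ-unique _ w (trans (trans (assoc a (b ∙ c) w) (cong (a ∙_) (assoc b c w))) e)

  infixr 8 _^_
  _^_ : Fin n → ℕ → Fin n
  a ^ zero  = ε
  a ^ suc k = a ∙ a ^ k

  ^-+ : ∀ a m k → a ^ (m + k) ≡ a ^ m ∙ a ^ k
  ^-+ a zero    k = sym (identityˡ _)
  ^-+ a (suc m) k = trans (cong (a ∙_) (^-+ a m k)) (sym (assoc _ _ _))

  ^-* : ∀ {a m} → a ^ m ≡ ε → ∀ q → a ^ (q * m) ≡ ε
  ^-* {a} {m} aᵐ≡ε zero    = refl
  ^-* {a} {m} aᵐ≡ε (suc q) = trans (^-+ a m (q * m)) (trans (cong₂ _∙_ aᵐ≡ε (^-* aᵐ≡ε q)) (identityˡ ε))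

  ^-% : ∀ {a} m .{{_ : NonZero m}} → a ^ m ≡ ε → ∀ k → a ^ (k % m) ≡ a ^ k
  ^-% {a} m aᵐ≡ε k = sym (begin
    a ^ k                             ≡⟨ cong (a ^_) (m≡m%n+[m/n]*n k m) ⟩
    a ^ (k % m + k / m * m)           ≡⟨ ^-+ a (k % m) _ ⟩
    a ^ (k % m) ∙ a ^ (k / m * m)     ≡⟨ cong (a ^ (k % m) ∙_) (^-* aᵐ≡ε (k / m)) ⟩
    a ^ (k % m) ∙ ε                   ≡⟨ identityʳ _ ⟩
    a ^ (k % m)                       ∎)
    where open ≡-Reasoning

  module _ {a b} (ab≡ba : a ∙ b ≡ b ∙ a) where

    ^-comm : ∀ k → b ∙ a ^ k ≡ a ^ k ∙ b
    ^-comm zero    = trans (identityʳ b) (sym (identityˡ b))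
    ^-comm (suc k) = begin
      b ∙ (a ∙ a ^ k)   ≡⟨ sym (assoc _ _ _) ⟩
      b ∙ a ∙ a ^ k     ≡⟨ cong (_∙ a ^ k) (sym ab≡ba) ⟩
      a ∙ b ∙ a ^ k     ≡⟨ assoc _ _ _ ⟩
      a ∙ (b ∙ a ^ k)   ≡⟨ cong (a ∙_) (^-comm k) ⟩
      a ∙ (a ^ k ∙ b)   ≡⟨ sym (assoc _ _ _) ⟩
      a ∙ a ^ k ∙ b     ∎
      where open ≡-Reasoning

    ∙-^ : ∀ k → (a ∙ b) ^ k ≡ a ^ k ∙ b ^ k
    ∙-^ zero    = sym (identityˡ ε)
    ∙-^ (suc k) = begin
      a ∙ b ∙ (a ∙ b) ^ k        ≡⟨ cong (a ∙ b ∙_) (∙-^ k) ⟩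
      a ∙ b ∙ (a ^ k ∙ b ^ k)    ≡⟨ assoc _ _ _ ⟩
      a ∙ (b ∙ (a ^ k ∙ b ^ k))  ≡⟨ cong (a ∙_) (sym (assoc _ _ _)) ⟩
      a ∙ (b ∙ a ^ k ∙ b ^ k)    ≡⟨ cong (λ t → a ∙ (t ∙ b ^ k)) (^-comm k) ⟩
      a ∙ (a ^ k ∙ b ∙ b ^ k)    ≡⟨ cong (a ∙_) (assoc _ _ _) ⟩
      a ∙ (a ^ k ∙ (b ∙ b ^ k))  ≡⟨ sym (assoc _ _ _) ⟩
      a ∙ a ^ k ∙ (b ∙ b ^ k)    ∎
      where open ≡-Reasoning

  conj : Fin n → Fin n → Fin n
  conj c a = c ⁻¹ ∙ a ∙ c

  conj-homo : ∀ c a b → conj c (a ∙ b) ≡ conj c a ∙ conj c b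
  conj-homo c a b = sym (begin
      (c ⁻¹ ∙ a ∙ c) ∙ (c ⁻¹ ∙ b ∙ c) ≡⟨ assoc _ _ _ ⟩
      c ⁻¹ ∙ a ∙ (c ∙ (c ⁻¹ ∙ b ∙ c)) ≡⟨ cong (c ⁻¹ ∙ a ∙_) (sym (assoc _ _ _)) ⟩
      c ⁻¹ ∙ a ∙ (c ∙ (c ⁻¹ ∙ b) ∙ c) ≡⟨ cong (λ t → c ⁻¹ ∙ a ∙ (t ∙ c)) (x∙[x⁻¹∙y]≡y c b) ⟩
      c ⁻¹ ∙ a ∙ (b ∙ c)              ≡⟨ sym (assoc _ _ _) ⟩
      c ⁻¹ ∙ a ∙ b ∙ c                ≡⟨ cong (_∙ c) (assoc _ _ _) ⟩
      c ⁻¹ ∙ (a ∙ b) ∙ c              ∎)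
    where open ≡-Reasoning

  module _ {h : Fin n → Fin n} (h-homo : ∀ a b → h (a ∙ b) ≡ h a ∙ h b) where

    homo-ε : h ε ≡ ε
    homo-ε = identityˡ-unique (h ε) (h ε) (trans (sym (h-homo ε ε)) (cong h (identityˡ ε)))

    homo-⁻¹ : ∀ a → h (a ⁻¹) ≡ h a ⁻¹
    homo-⁻¹ a = inverseʳ-unique (h a) (h (a ⁻¹))
                  (trans (sym (h-homo a (a ⁻¹))) (trans (cong h (inverseʳ a)) homo-ε))

module CayleyGraph (G : FinGroup) (S : Fin (FinGroup.n G) → Set) where
  open FinGroupProperties G

  Arc : Fin n → Fin n → Set
  Arc = CayArc G S

  arc-to : ∀ {s} u → S s → Arc u (s ∙ u)
  arc-to {s} u s∈S = subst S (sym ([y∙x]∙x⁻¹≡y u s)) s∈S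

  arc-label : ∀ {u v} → Arc u v → Σ (Fin n) λ s → S s × v ≡ s ∙ u
  arc-label {u} {v} a = v ∙ u ⁻¹ , a , sym ([y∙x⁻¹]∙x≡y u v)

  isAut-resp-≗ : ∀ {f g} → (∀ a → f a ≡ g a) → IsAut G S g → IsAut G S f
  isAut-resp-≗ {f} {g} f≗g ((g-inj , g-surj) , g-arcs) = (f-inj , f-surj) , f-arcs
    where
    f-inj : ∀ {a b} → f a ≡ f b → a ≡ b
    f-inj {a} {b} e = g-inj (trans (sym (f≗g a)) (trans e (f≗g b)))
    f-surj : ∀ t → Σ (Fin n) λ a → ∀ {w} → w ≡ a → f w ≡ t
    f-surj t = proj₁ (g-surj t) , λ {w} e → trans (f≗g w) (proj₂ (g-surj t) e)
    f-arcs : ∀ u v → (Arc u v → Arc (f u) (f v)) × (Arc (f u) (f v) → Arc u v)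
    f-arcs u v = (λ a → subst₂ Arc (sym (f≗g u)) (sym (f≗g v)) (proj₁ (g-arcs u v) a))
               , (λ a → proj₂ (g-arcs u v) (subst₂ Arc (f≗g u) (f≗g v) a))

  ∘-isAut : ∀ {f g} → IsAut G S f → IsAut G S g → IsAut G S (g ∘ f)
  ∘-isAut {f} {g} (f-bij , f-arcs) (g-bij , g-arcs) =
    Composition.bijective _≡_ _≡_ _≡_ f-bij g-bij ,
    λ u v → (proj₁ (g-arcs (f u) (f v)) ∘ proj₁ (f-arcs u v))
          , (proj₂ (f-arcs u v) ∘ proj₂ (g-arcs (f u) (f v)))

  rightMul-isAut : ∀ c → IsAut G S (_∙ c)
  rightMul-isAut c = (∙-cancelʳ c _ _ , λ t → t ∙ c ⁻¹ , λ { refl → [y∙x⁻¹]∙x≡y c t })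
                   , λ u v → subst S (sym (label u v)) , subst S (label u v)
    where
    label : ∀ u v → v ∙ c ∙ (u ∙ c) ⁻¹ ≡ v ∙ u ⁻¹
    label u v = begin
      v ∙ c ∙ (u ∙ c) ⁻¹      ≡⟨ cong (v ∙ c ∙_) (⁻¹-anti-homo-∙ u c) ⟩
      v ∙ c ∙ (c ⁻¹ ∙ u ⁻¹)   ≡⟨ assoc _ _ _ ⟩
      v ∙ (c ∙ (c ⁻¹ ∙ u ⁻¹)) ≡⟨ cong (v ∙_) (x∙[x⁻¹∙y]≡y c _) ⟩
      v ∙ u ⁻¹                ∎
      where open ≡-Reasoning

  involutiveHomo-isAut : ∀ {h} → (∀ a b → h (a ∙ b) ≡ h a ∙ h b) → (∀ a → h (h a) ≡ a)
                       → (∀ {s} → S s → S (h s)) → IsAut G S h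
  involutiveHomo-isAut {h} h-homo h-invol h-S =
    (h-inj , λ t → h t , λ { refl → h-invol t })
    , λ u v → (λ a → subst S (label u v) (h-S a))
            , (λ a → subst S (h-invol _) (h-S (subst S (sym (label u v)) a)))
    where
    h-inj : ∀ {a b} → h a ≡ h b → a ≡ b
    h-inj {a} {b} e = trans (sym (h-invol a)) (trans (cong h e) (h-invol b))
    label : ∀ u v → h (v ∙ u ⁻¹) ≡ h v ∙ h u ⁻¹
    label u v = trans (h-homo v (u ⁻¹)) (cong (h v ∙_) (homo-⁻¹ h-homo u))

  OnTriangle : Fin n → Fin n → Set
  OnTriangle u v = Σ (Fin n) λ w → Arc v w × Arc w u

  module _ {f} (aut : IsAut G S f) where

    isAut-injective : ∀ {a b} → f a ≡ f b → a ≡ b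
    isAut-injective = proj₁ (proj₁ aut)

    isAut-preserves-arc : ∀ {u v} → Arc u v → Arc (f u) (f v)
    isAut-preserves-arc {u} {v} = proj₁ (proj₂ aut u v)

    isAut-reflects-arc : ∀ {u v} → Arc (f u) (f v) → Arc u v
    isAut-reflects-arc {u} {v} = proj₂ (proj₂ aut u v)

    isAut-preserves-triangle : ∀ {u v} → OnTriangle u v → OnTriangle (f u) (f v)
    isAut-preserves-triangle (w , vw , wu) = f w , isAut-preserves-arc vw , isAut-preserves-arc wu

    isAut-reflects-triangle : ∀ {u v} → OnTriangle (f u) (f v) → OnTriangle u v
    isAut-reflects-triangle {u} {v} (w′ , vw′ , w′u) =
      w , isAut-reflects-arc (subst (Arc (f v)) (sym fw≡w′) vw′)
        , isAut-reflects-arc (subst (λ t → Arc t (f u)) (sym fw≡w′) w′u)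
      where
      w : Fin n
      w = proj₁ (proj₂ (proj₁ aut) w′)
      fw≡w′ : f w ≡ w′
      fw≡w′ = proj₂ (proj₂ (proj₁ aut) w′) refl

tabulate-injective : ∀ {A : Set} {m} {h k : Fin m → A} → tabulate h ≡ tabulate k → ∀ i → h i ≡ k i
tabulate-injective {h = h} {k} e i =
  trans (sym (lookup∘tabulate h i)) (trans (cong (λ v → lookup v i) e) (lookup∘tabulate k i))

tabulate-≗lookup : ∀ {A : Set} {m} (v : Vec A m) {h : Fin m → A} → (∀ i → lookup v i ≡ h i) → tabulate h ≡ v
tabulate-≗lookup v e = trans (sym (tabulate-cong e)) (tabulate∘lookup v)

module IndexTwo (G : FinGroup) (x y : Fin (FinGroup.n G))
  (x-invol : IsInvolution G x) (y-order3 : HasOrder3 G y)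
  (y≢z : ¬ y ≡ FinGroupProperties.conj G x y) (generated : Generates G x y)
  where
  open FinGroupProperties G

  z : Fin n
  z = conj x y

  S : Fin n → Set
  S s = (s ≡ x) ⊎ (s ≡ y) ⊎ (s ≡ z)

  open CayleyGraph G S

  x∙x≡ε : x ∙ x ≡ ε
  x∙x≡ε = proj₂ x-invol

  x⁻¹≡x : x ⁻¹ ≡ x
  x⁻¹≡x = x∙x≡ε⇒x⁻¹≡x x∙x≡ε

  x∙[x∙u]≡u : ∀ u → x ∙ (x ∙ u) ≡ u
  x∙[x∙u]≡u u = trans (cong (_∙ (x ∙ u)) (sym x⁻¹≡x)) (x⁻¹∙[x∙y]≡y x u)

  y∙[x∙u]≡x∙[z∙u] : ∀ u → y ∙ (x ∙ u) ≡ x ∙ (z ∙ u)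
  y∙[x∙u]≡x∙[z∙u] u = begin
    y ∙ (x ∙ u)              ≡⟨ sym (x∙[x⁻¹∙y]≡y x _) ⟩
    x ∙ (x ⁻¹ ∙ (y ∙ (x ∙ u))) ≡⟨ cong (x ∙_) (sym (assoc _ _ _)) ⟩
    x ∙ (x ⁻¹ ∙ y ∙ (x ∙ u))   ≡⟨ cong (x ∙_) (sym (assoc _ _ _)) ⟩
    x ∙ (z ∙ u)              ∎
    where open ≡-Reasoning

  τ : Fin n → Fin n
  τ = conj x

  τ-involutive : ∀ a → τ (τ a) ≡ a
  τ-involutive a = begin
    x ⁻¹ ∙ (x ⁻¹ ∙ a ∙ x) ∙ x ≡⟨ cong (λ t → t ∙ (t ∙ a ∙ x) ∙ x) x⁻¹≡x ⟩
    x ∙ (x ∙ a ∙ x) ∙ x       ≡⟨ assoc _ _ _ ⟩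
    x ∙ (x ∙ a ∙ x ∙ x)       ≡⟨ cong (x ∙_) (assoc _ _ _) ⟩
    x ∙ (x ∙ a ∙ (x ∙ x))     ≡⟨ cong (λ t → x ∙ (x ∙ a ∙ t)) x∙x≡ε ⟩
    x ∙ (x ∙ a ∙ ε)           ≡⟨ cong (x ∙_) (identityʳ _) ⟩
    x ∙ (x ∙ a)               ≡⟨ x∙[x∙u]≡u a ⟩
    a                         ∎
    where open ≡-Reasoning

  τ-isAut : IsAut G S τ
  τ-isAut = involutiveHomo-isAut (conj-homo x) τ-involutive τ-S
    where
    τ-S : ∀ {s} → S s → S (τ s)
    τ-S (inj₁ refl)        = inj₁ (trans (cong (_∙ x) (inverseˡ x)) (identityˡ x))
    τ-S (inj₂ (inj₁ refl)) = inj₂ (inj₂ refl)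
    τ-S (inj₂ (inj₂ refl)) = inj₂ (inj₁ (τ-involutive y))

  InYZ : Fin n → Set
  InYZ p = (p ≡ y) ⊎ (p ≡ z)

  inYZ-cube : ∀ {p} → InYZ p → p ∙ p ∙ p ≡ ε
  inYZ-cube (inj₁ refl) = proj₂ y-order3
  inYZ-cube (inj₂ refl) = begin
    τ y ∙ τ y ∙ τ y   ≡⟨ cong (_∙ τ y) (sym (conj-homo x y y)) ⟩
    τ (y ∙ y) ∙ τ y   ≡⟨ sym (conj-homo x (y ∙ y) y) ⟩
    τ (y ∙ y ∙ y)     ≡⟨ cong τ (proj₂ y-order3) ⟩
    τ ε               ≡⟨ homo-ε (conj-homo x) ⟩
    ε                 ∎
    where open ≡-Reasoning

  S-nontrivial : ∀ {s} → S s → ¬ s ≡ ε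
  S-nontrivial (inj₁ refl)        = proj₁ x-invol
  S-nontrivial (inj₂ (inj₁ refl)) = proj₁ y-order3
  S-nontrivial (inj₂ (inj₂ refl)) z≡ε =
    proj₁ y-order3 (trans (sym (τ-involutive y)) (trans (cong τ z≡ε) (homo-ε (conj-homo x))))

  inYZ≢x : ∀ {p} → InYZ p → ¬ p ≡ x
  inYZ≢x p∈YZ refl = proj₁ x-invol (begin
    x             ≡⟨ sym (identityˡ x) ⟩
    ε ∙ x         ≡⟨ cong (_∙ x) (sym x∙x≡ε) ⟩
    x ∙ x ∙ x     ≡⟨ inYZ-cube p∈YZ ⟩
    ε             ∎)
    where open ≡-Reasoning

  y∙[x∙y]≢ε : ¬ y ∙ (x ∙ y) ≡ ε
  y∙[x∙y]≢ε e = inYZ≢x (inj₁ refl) (sym (p∙[q∙p]≡ε⇒q≡p (proj₂ y-order3) e))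

  z∙x≡x∙y : z ∙ x ≡ x ∙ y
  z∙x≡x∙y = begin
    x ⁻¹ ∙ y ∙ x ∙ x   ≡⟨ assoc _ _ _ ⟩
    x ⁻¹ ∙ y ∙ (x ∙ x) ≡⟨ cong (x ⁻¹ ∙ y ∙_) x∙x≡ε ⟩
    x ⁻¹ ∙ y ∙ ε       ≡⟨ identityʳ _ ⟩
    x ⁻¹ ∙ y           ≡⟨ cong (_∙ y) x⁻¹≡x ⟩
    x ∙ y              ∎
    where open ≡-Reasoning

  square≢x : ∀ {p} → InYZ p → ¬ p ∙ p ≡ x
  square≢x p∈YZ e =
    inYZ≢x p∈YZ (trans (sym ([p∙p]⁻¹≡p (inYZ-cube p∈YZ))) (trans (cong _⁻¹ e) x⁻¹≡x))

  yz-product≢x : ∀ {c d} → InYZ c → InYZ d → ¬ d ∙ c ≡ x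
  yz-product≢x (inj₁ refl) (inj₁ refl) e = square≢x (inj₁ refl) e
  yz-product≢x (inj₂ refl) (inj₂ refl) e = square≢x (inj₂ refl) e
  yz-product≢x (inj₁ refl) (inj₂ refl) e =
    y∙[x∙y]≢ε (trans (y∙[x∙u]≡x∙[z∙u] y) (trans (cong (x ∙_) e) x∙x≡ε))
  yz-product≢x (inj₂ refl) (inj₁ refl) e = y∙[x∙y]≢ε (begin
    y ∙ (x ∙ y) ≡⟨ cong (y ∙_) (sym z∙x≡x∙y) ⟩
    y ∙ (z ∙ x) ≡⟨ sym (assoc y z x) ⟩
    y ∙ z ∙ x   ≡⟨ cong (_∙ x) e ⟩
    x ∙ x       ≡⟨ x∙x≡ε ⟩
    ε           ∎)
    where open ≡-Reasoning

  x-walk-not-closed : ∀ {c d} → S c → S d → ¬ d ∙ (c ∙ x) ≡ ε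
  x-walk-not-closed {d = d} (inj₁ refl) d∈S e =
    S-nontrivial d∈S (trans (sym (identityʳ d)) (trans (cong (d ∙_) (sym x∙x≡ε)) e))
  x-walk-not-closed {c} (inj₂ c∈YZ) (inj₁ refl) e =
    S-nontrivial (inj₂ c∈YZ) (trans (sym (identityʳ c)) (trans (cong (c ∙_) (sym x∙x≡ε))
      (trans (sym (assoc c x x)) (x∙y≡ε⇒y∙x≡ε e))))
  x-walk-not-closed {c} {d} (inj₂ c∈YZ) (inj₂ d∈YZ) e =
    yz-product≢x c∈YZ d∈YZ (trans (inverseˡ-unique (d ∙ c) x (trans (assoc d c x) e)) x⁻¹≡x)

  zy-walk-not-closed : ∀ {t} → InYZ t → ¬ t ∙ (z ∙ y) ≡ ε
  zy-walk-not-closed (inj₁ refl) e = y≢z (sym (p∙[q∙p]≡ε⇒q≡p (proj₂ y-order3) e))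
  zy-walk-not-closed (inj₂ refl) e = y≢z (p∙[p∙q]≡ε⇒q≡p (inYZ-cube (inj₂ refl)) e)

  yz-arc-on-triangle : ∀ {p} → InYZ p → ∀ u → OnTriangle u (p ∙ u)
  yz-arc-on-triangle {p} p∈YZ u =
    p ∙ (p ∙ u) , arc-to (p ∙ u) (inj₂ p∈YZ)
                , subst (Arc (p ∙ (p ∙ u))) (p∙[p∙[p∙q]]≡q (inYZ-cube p∈YZ) u) (arc-to _ (inj₂ p∈YZ))

  x-arc-off-triangle : ∀ u → ¬ OnTriangle u (x ∙ u)
  x-arc-off-triangle u (w , xu→w , w→u) with arc-label xu→w | arc-label w→u
  ... | c , c∈S , w≡c∙xu | d , d∈S , u≡d∙w =
    x-walk-not-closed c∈S d∈S
      (x∙[y∙[z∙w]]≡w⇒x∙[y∙z]≡ε d c x u (sym (trans u≡d∙w (cong (d ∙_) w≡c∙xu))))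

  module Automorphism {f} (aut : IsAut G S f) where

    isAut-arc-label : ∀ {s} u → S s → Σ (Fin n) λ s′ → S s′ × f (s ∙ u) ≡ s′ ∙ f u
    isAut-arc-label u s∈S = arc-label (isAut-preserves-arc aut (arc-to u s∈S))

    isAut-x : ∀ u → f (x ∙ u) ≡ x ∙ f u
    isAut-x u with isAut-arc-label u (inj₁ refl)
    ... | _ , inj₁ refl , e = e
    ... | _ , inj₂ s∈YZ , e = ⊥-elim (x-arc-off-triangle u (isAut-reflects-triangle aut
            (subst (OnTriangle (f u)) (sym e) (yz-arc-on-triangle s∈YZ (f u)))))

    isAut-yz : ∀ {p} → InYZ p → ∀ u → Σ (Fin n) λ s → InYZ s × f (p ∙ u) ≡ s ∙ f u
    isAut-yz p∈YZ u with isAut-arc-label u (inj₂ p∈YZ)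
    ... | _ , inj₂ s∈YZ , e = _ , s∈YZ , e
    ... | _ , inj₁ refl , e = ⊥-elim (x-arc-off-triangle (f u)
            (subst (OnTriangle (f u)) e (isAut-preserves-triangle aut (yz-arc-on-triangle p∈YZ u))))

    KeepsColour : Fin n → Set
    KeepsColour u = f (y ∙ u) ≡ y ∙ f u

    keepsColour-z : ∀ {u} → KeepsColour u → f (z ∙ u) ≡ z ∙ f u
    keepsColour-z {u} k with isAut-yz (inj₂ refl) u
    ... | _ , inj₂ refl , e = e
    ... | _ , inj₁ refl , e = ⊥-elim (y≢z (sym (∙-cancelʳ u z y (isAut-injective aut (trans e (sym k))))))

    keepsColour-x∙ : ∀ {u} → KeepsColour u → KeepsColour (x ∙ u)
    keepsColour-x∙ {u} k = begin
      f (y ∙ (x ∙ u)) ≡⟨ cong f (y∙[x∙u]≡x∙[z∙u] u) ⟩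
      f (x ∙ (z ∙ u)) ≡⟨ isAut-x (z ∙ u) ⟩
      x ∙ f (z ∙ u)   ≡⟨ cong (x ∙_) (keepsColour-z k) ⟩
      x ∙ (z ∙ f u)   ≡⟨ sym (y∙[x∙u]≡x∙[z∙u] (f u)) ⟩
      y ∙ (x ∙ f u)   ≡⟨ cong (y ∙_) (sym (isAut-x u)) ⟩
      y ∙ f (x ∙ u)   ∎
      where open ≡-Reasoning

    -- Otherwise f sends the y-triangle through u to a closed walk of shape y, z, y or y, z, z.
    keepsColour-y∙ : ∀ {u} → KeepsColour u → KeepsColour (y ∙ u)
    keepsColour-y∙ {u} k with isAut-yz (inj₁ refl) (y ∙ u)
    ... | _ , inj₁ refl , e = e
    ... | _ , inj₂ refl , e with isAut-yz (inj₁ refl) (y ∙ (y ∙ u))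
    ...   | t , t∈YZ , e′ = ⊥-elim (zy-walk-not-closed t∈YZ
            (x∙[y∙[z∙w]]≡w⇒x∙[y∙z]≡ε t z y (f u) (sym (begin
              f u                           ≡⟨ cong f (sym (p∙[p∙[p∙q]]≡q (proj₂ y-order3) u)) ⟩
              f (y ∙ (y ∙ (y ∙ u)))         ≡⟨ e′ ⟩
              t ∙ f (y ∙ (y ∙ u))           ≡⟨ cong (t ∙_) e ⟩
              t ∙ (z ∙ f (y ∙ u))           ≡⟨ cong (λ a → t ∙ (z ∙ a)) k ⟩
              t ∙ (z ∙ (y ∙ f u))           ∎))))
      where open ≡-Reasoning

    keepsColour-invariant : ∀ {a} → Gen G x y a → ∀ u
                          → (KeepsColour u → KeepsColour (a ∙ u)) × (KeepsColour (a ∙ u) → KeepsColour u)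
    keepsColour-invariant gen-x u = keepsColour-x∙ , subst KeepsColour (x∙[x∙u]≡u u) ∘ keepsColour-x∙
    keepsColour-invariant gen-y u =
      keepsColour-y∙ , subst KeepsColour (p∙[p∙[p∙q]]≡q (proj₂ y-order3) u) ∘ keepsColour-y∙ ∘ keepsColour-y∙
    keepsColour-invariant gen-ε u = subst KeepsColour (sym (identityˡ u)) , subst KeepsColour (identityˡ u)
    keepsColour-invariant (gen-∙ {a} {b} a∈ b∈) u =
        subst KeepsColour (sym (assoc a b u)) ∘ proj₁ (keepsColour-invariant a∈ (b ∙ u)) ∘ proj₁ (keepsColour-invariant b∈ u)
      , proj₂ (keepsColour-invariant b∈ u) ∘ proj₂ (keepsColour-invariant a∈ (b ∙ u)) ∘ subst KeepsColour (assoc a b u)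
    keepsColour-invariant (gen-inv {a} a∈) u =
        proj₂ (keepsColour-invariant a∈ (a ⁻¹ ∙ u)) ∘ subst KeepsColour (sym (x∙[x⁻¹∙y]≡y a u))
      , subst KeepsColour (x∙[x⁻¹∙y]≡y a u) ∘ proj₁ (keepsColour-invariant a∈ (a ⁻¹ ∙ u))

    commutes-with-generated : (∀ u → KeepsColour u) → ∀ {a} → Gen G x y a → ∀ u → f (a ∙ u) ≡ a ∙ f u
    commutes-with-generated keeps gen-x = isAut-x
    commutes-with-generated keeps gen-y = keeps
    commutes-with-generated keeps gen-ε u = trans (cong f (identityˡ u)) (sym (identityˡ (f u)))
    commutes-with-generated keeps (gen-∙ {a} {b} a∈ b∈) u = begin
      f (a ∙ b ∙ u)     ≡⟨ cong f (assoc a b u) ⟩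
      f (a ∙ (b ∙ u))   ≡⟨ commutes-with-generated keeps a∈ (b ∙ u) ⟩
      a ∙ f (b ∙ u)     ≡⟨ cong (a ∙_) (commutes-with-generated keeps b∈ u) ⟩
      a ∙ (b ∙ f u)     ≡⟨ sym (assoc a b (f u)) ⟩
      a ∙ b ∙ f u       ∎
      where open ≡-Reasoning
    commutes-with-generated keeps (gen-inv {a} a∈) u = begin
      f (a ⁻¹ ∙ u)                ≡⟨ sym (x⁻¹∙[x∙y]≡y a _) ⟩
      a ⁻¹ ∙ (a ∙ f (a ⁻¹ ∙ u))   ≡⟨ cong (a ⁻¹ ∙_) (sym (commutes-with-generated keeps a∈ (a ⁻¹ ∙ u))) ⟩
      a ⁻¹ ∙ f (a ∙ (a ⁻¹ ∙ u))   ≡⟨ cong (λ t → a ⁻¹ ∙ f t) (x∙[x⁻¹∙y]≡y a u) ⟩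
      a ⁻¹ ∙ f u                  ∎
      where open ≡-Reasoning

    keepsColour⇒translation : KeepsColour ε → ∀ g → f g ≡ g ∙ f ε
    keepsColour⇒translation k g =
      trans (cong f (sym (identityʳ g))) (commutes-with-generated keeps (generated g) ε)
      where
      keeps : ∀ u → KeepsColour u
      keeps u = subst KeepsColour (identityʳ u) (proj₁ (keepsColour-invariant (generated u) ε) k)

  classify : ∀ {f} → IsAut G S f → (∀ g → f g ≡ g ∙ f ε) ⊎ (∀ g → f g ≡ τ g ∙ f ε)
  classify {f} aut with Automorphism.isAut-yz aut (inj₁ refl) ε
  ... | _ , inj₁ refl , e = inj₁ (Automorphism.keepsColour⇒translation aut e)
  ... | _ , inj₂ refl , e = inj₂ λ g → begin
      f g                 ≡⟨ sym (τ-involutive (f g)) ⟩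
      τ (τ (f g))         ≡⟨ cong τ (Automorphism.keepsColour⇒translation (∘-isAut aut τ-isAut) τf-keeps g) ⟩
      τ (g ∙ τ (f ε))     ≡⟨ conj-homo x g _ ⟩
      τ g ∙ τ (τ (f ε))   ≡⟨ cong (τ g ∙_) (τ-involutive (f ε)) ⟩
      τ g ∙ f ε           ∎
    where
    open ≡-Reasoning
    τf-keeps : τ (f (y ∙ ε)) ≡ y ∙ τ (f ε)
    τf-keeps = begin
      τ (f (y ∙ ε))   ≡⟨ cong τ e ⟩
      τ (z ∙ f ε)     ≡⟨ conj-homo x z (f ε) ⟩
      τ z ∙ τ (f ε)   ≡⟨ cong (_∙ τ (f ε)) (τ-involutive y) ⟩
      y ∙ τ (f ε)     ∎

  translation twisted : Fin n → Vec (Fin n) n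
  translation c = tabulate (_∙ c)
  twisted     c = tabulate (λ g → τ g ∙ c)

  autTables : List (Vec (Fin n) n)
  autTables = map translation (allFin n) ++ map twisted (allFin n)

  autTables-sound : ∀ v → v ∈ autTables → IsAut G S (lookup v)
  autTables-sound v v∈ with ∈-++⁻ (map translation (allFin n)) v∈
  ... | inj₁ v∈₁ with ∈-map⁻ translation v∈₁
  ...   | c , _ , refl = isAut-resp-≗ (lookup∘tabulate _) (rightMul-isAut c)
  autTables-sound v v∈ | inj₂ v∈₂ with ∈-map⁻ twisted v∈₂
  ...   | c , _ , refl = isAut-resp-≗ (lookup∘tabulate _) (∘-isAut τ-isAut (rightMul-isAut c))

  autTables-complete : ∀ v → IsAut G S (lookup v) → v ∈ autTables
  autTables-complete v aut with classify aut
  ... | inj₁ e = subst (_∈ autTables) (tabulate-≗lookup v e)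
                   (∈-++⁺ˡ (∈-map⁺ translation (∈-allFin (lookup v ε))))
  ... | inj₂ e = subst (_∈ autTables) (tabulate-≗lookup v e)
                   (∈-++⁺ʳ (map translation (allFin n)) (∈-map⁺ twisted (∈-allFin (lookup v ε))))

  autTables-unique : Unique autTables
  autTables-unique =
    ++⁺ (map⁺ translation-injective (allFin⁺ n)) (map⁺ twisted-injective (allFin⁺ n)) disjoint
    where
    translation-injective : ∀ {c c′} → translation c ≡ translation c′ → c ≡ c′
    translation-injective e = ∙-cancelˡ ε _ _ (tabulate-injective e ε)
    twisted-injective : ∀ {c c′} → twisted c ≡ twisted c′ → c ≡ c′
    twisted-injective e = ∙-cancelˡ (τ ε) _ _ (tabulate-injective e ε)
    disjoint : ∀ {v} → ¬ (v ∈ map translation (allFin n) × v ∈ map twisted (allFin n))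
    disjoint (v∈₁ , v∈₂) with ∈-map⁻ translation v∈₁ | ∈-map⁻ twisted v∈₂
    ... | c , _ , refl | c′ , _ , e =
      y≢z (∙-cancelʳ c y z (trans (tabulate-injective e y) (cong (z ∙_) (sym c≡c′))))
      where
      c≡c′ : c ≡ c′
      c≡c′ = trans (sym (identityˡ c)) (trans (tabulate-injective e ε)
                     (trans (cong (_∙ c′) (homo-ε (conj-homo x))) (identityˡ c′)))

  autTables-length : length autTables ≡ 2 * n
  autTables-length = begin
    length autTables                     ≡⟨ length-++ (map translation (allFin n)) ⟩
    length (map translation (allFin n))
      + length (map twisted (allFin n))  ≡⟨ cong₂ _+_ (length-tables translation) (length-tables twisted) ⟩
    n + n                                ≡⟨ cong (n +_) (sym (+-identityʳ n)) ⟩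
    2 * n                                ∎
    where
    open ≡-Reasoning
    length-tables : (t : Fin n → Vec (Fin n) n) → length (map t (allFin n)) ≡ n
    length-tables t = trans (length-map t (allFin n)) (length-tabulate (λ a → a))

  cayleyIndex-two : CayleyIndex G S 2
  cayleyIndex-two = autTables , autTables-unique
                  , (λ v → autTables-sound v , autTables-complete v) , autTables-length

infix 30 -₆_
-₆_ : ℤ₆ → ℤ₆
-₆ k = fromℕ< (m%n<n (6 ∸ toℕ k) 6)

+₆-inverseʳ : ∀ k → k +₆ -₆ k ≡ zero
+₆-inverseʳ = from-yes (all? λ k → k +₆ -₆ k ≟ zero)

+₆-difference-zero : ∀ i j → j +₆ -₆ i ≡ zero → j ≡ i
+₆-difference-zero = from-yes (all? λ i → all? λ j → (j +₆ -₆ i ≟ zero) →-dec (j ≟ i))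

module CyclicCase (G : FinGroup) (x y : Fin (FinGroup.n G))
  (x-invol : IsInvolution G x) (y-order3 : HasOrder3 G y)
  (y≡z : y ≡ FinGroupProperties.conj G x y) (generated : Generates G x y)
  where
  open FinGroupProperties G

  x∙y≡y∙x : x ∙ y ≡ y ∙ x
  x∙y≡y∙x = trans (cong (x ∙_) y≡z) (trans (cong (x ∙_) (assoc _ _ _)) (x∙[x⁻¹∙y]≡y x (y ∙ x)))

  g : Fin n
  g = x ∙ y

  g^k≡x^[k%2]∙y^[k%3] : ∀ k → g ^ k ≡ x ^ (k % 2) ∙ y ^ (k % 3)
  g^k≡x^[k%2]∙y^[k%3] k = begin
    g ^ k                       ≡⟨ ∙-^ x∙y≡y∙x k ⟩
    x ^ k ∙ y ^ k               ≡⟨ cong₂ _∙_ (sym (^-% 2 x²≡ε k)) (sym (^-% 3 y³≡ε k)) ⟩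
    x ^ (k % 2) ∙ y ^ (k % 3)   ∎
    where
    open ≡-Reasoning
    x²≡ε : x ^ 2 ≡ ε
    x²≡ε = trans (cong (x ∙_) (identityʳ x)) (proj₂ x-invol)
    y³≡ε : y ^ 3 ≡ ε
    y³≡ε = trans (sym (assoc y y _)) (trans (cong (y ∙ y ∙_) (identityʳ y)) (proj₂ y-order3))

  g³≡x : g ^ 3 ≡ x
  g³≡x = trans (g^k≡x^[k%2]∙y^[k%3] 3) (trans (identityʳ _) (identityʳ x))

  g⁴≡y : g ^ 4 ≡ y
  g⁴≡y = trans (g^k≡x^[k%2]∙y^[k%3] 4) (trans (identityˡ _) (identityʳ y))

  g⁶≡ε : g ^ 6 ≡ ε
  g⁶≡ε = trans (g^k≡x^[k%2]∙y^[k%3] 6) (identityˡ ε)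

  ψ : ℤ₆ → Fin n
  ψ k = g ^ toℕ k

  ψ-homo : ∀ a b → ψ (a +₆ b) ≡ ψ a ∙ ψ b
  ψ-homo a b = begin
    g ^ toℕ (a +₆ b)              ≡⟨ cong (g ^_) (toℕ-fromℕ< (m%n<n (toℕ a + toℕ b) 6)) ⟩
    g ^ ((toℕ a + toℕ b) % 6)     ≡⟨ ^-% 6 g⁶≡ε (toℕ a + toℕ b) ⟩
    g ^ (toℕ a + toℕ b)           ≡⟨ ^-+ g (toℕ a) (toℕ b) ⟩
    ψ a ∙ ψ b                     ∎
    where open ≡-Reasoning

  ψ-neg : ∀ k → ψ (-₆ k) ≡ ψ k ⁻¹
  ψ-neg k = inverseʳ-unique (ψ k) _ (trans (sym (ψ-homo k (-₆ k))) (cong ψ (+₆-inverseʳ k)))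

  g³≢ε : ¬ g ^ 3 ≡ ε
  g³≢ε e = proj₁ x-invol (trans (sym g³≡x) e)

  g⁴≢ε : ¬ g ^ 4 ≡ ε
  g⁴≢ε e = proj₁ y-order3 (trans (sym g⁴≡y) e)

  g-multiple : ∀ m → g ^ m ≡ ε → ∀ q → g ^ ((q * m) % 6) ≡ ε
  g-multiple m gᵐ≡ε q = trans (^-% 6 g⁶≡ε (q * m)) (^-* {g} {m} gᵐ≡ε q)

  -- If g ^ m ≡ ε with 0 < m < 6, then some multiple of m is 3 or 4 modulo 6.
  ψ-kernel : ∀ k → ψ k ≡ ε → k ≡ zero
  ψ-kernel zero                                e = refl
  ψ-kernel (suc zero)                          e = ⊥-elim (g³≢ε (g-multiple 1 e 3))
  ψ-kernel (suc (suc zero))                    e = ⊥-elim (g⁴≢ε (g-multiple 2 e 2))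
  ψ-kernel (suc (suc (suc zero)))              e = ⊥-elim (g³≢ε e)
  ψ-kernel (suc (suc (suc (suc zero))))        e = ⊥-elim (g⁴≢ε e)
  ψ-kernel (suc (suc (suc (suc (suc zero))))) e = ⊥-elim (g³≢ε (g-multiple 5 e 3))

  ψ-injective : ∀ {i j} → ψ i ≡ ψ j → i ≡ j
  ψ-injective {i} {j} e = sym (+₆-difference-zero i j (ψ-kernel _ (begin
    ψ (j +₆ -₆ i)    ≡⟨ ψ-homo j (-₆ i) ⟩
    ψ j ∙ ψ (-₆ i)   ≡⟨ cong₂ _∙_ (sym e) (ψ-neg i) ⟩
    ψ i ∙ ψ i ⁻¹     ≡⟨ inverseʳ (ψ i) ⟩
    ε                ∎)))
    where open ≡-Reasoning

  ψ-onto-generated : ∀ {a} → Gen G x y a → Σ ℤ₆ λ k → ψ k ≡ a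
  ψ-onto-generated gen-x = # 3 , g³≡x
  ψ-onto-generated gen-y = # 4 , g⁴≡y
  ψ-onto-generated gen-ε = zero , refl
  ψ-onto-generated (gen-∙ a∈ b∈) with ψ-onto-generated a∈ | ψ-onto-generated b∈
  ... | k , refl | k′ , refl = k +₆ k′ , ψ-homo k k′
  ψ-onto-generated (gen-inv a∈) with ψ-onto-generated a∈
  ... | k , refl = -₆ k , ψ-neg k

  isomorphic : Isomorphic G ℤ₆ _+₆_
  isomorphic = φ , (φ-injective , φ-surjective) , φ-homo
    where
    φ : Fin n → ℤ₆
    φ a = proj₁ (ψ-onto-generated (generated a))
    ψ∘φ : ∀ a → ψ (φ a) ≡ a
    ψ∘φ a = proj₂ (ψ-onto-generated (generated a))
    φ-injective : ∀ {a b} → φ a ≡ φ b → a ≡ b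
    φ-injective {a} {b} e = trans (sym (ψ∘φ a)) (trans (cong ψ e) (ψ∘φ b))
    φ-surjective : ∀ k → Σ (Fin n) λ a → ∀ {b} → b ≡ a → φ b ≡ k
    φ-surjective k = ψ k , λ { refl → ψ-injective (ψ∘φ (ψ k)) }
    φ-homo : ∀ a b → φ (a ∙ b) ≡ φ a +₆ φ b
    φ-homo a b = ψ-injective (trans (ψ∘φ (a ∙ b))
                   (sym (trans (ψ-homo (φ a) (φ b)) (cong₂ _∙_ (ψ∘φ a) (ψ∘φ b)))))

proposition5p2 : (G : FinGroup) → (x y : Fin (FinGroup.n G))
    → IsInvolution G x → HasOrder3 G y → Generates G x y
    → ¬ Isomorphic G ℤ₆ _+₆_
    → ¬ Isomorphic G ℤ₃≀ℤ₂ _⋆≀_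
    → CayleyIndex G (λ s → (s ≡ x) ⊎ (s ≡ y) ⊎ (s ≡ FinGroup._∙_ G (FinGroup._∙_ G (FinGroup._⁻¹ G x) y) x)) 2
proposition5p2 G x y x-invol y-order3 generated G≇ℤ₆ _ with y ≟ FinGroupProperties.conj G x y
... | yes y≡z = ⊥-elim (G≇ℤ₆ (CyclicCase.isomorphic G x y x-invol y-order3 y≡z generated))
... | no y≢z  = IndexTwo.cayleyIndex-two G x y x-invol y-order3 y≢z generated
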